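{- Let $N\ge 2$ be an integer and, for $n\ge 0$, let $\kappa_n$ be the coefficient of $x^{N-1}$ in the remainder of $(x^{N-1}+1)^n$ upon division by $x^N+x-1$ in $\mathbb{Q}[x]$. Then $\kappa_0=0$ and $\kappa_n=1$ for all $0<n\le N-1$.
   Context: The remainder is the unique polynomial of degree at most $N-1$ congruent to $(x^{N-1}+1)^n$ modulo $x^N+x-1$ (obtained by repeatedly replacing $x^N$ by $1-x$). -}

module Defs where

open import Data.Nat using (ℕ; zero; suc)
open import Data.Rational using (ℚ; 0ℚ; 1ℚ; _+_; _-_; _*_)
open import Data.List using (List; []; _∷_; replicate; _++_; [_])
open import Data.Vec using (Vec; _∷_; last; init; lookup; zipWith; map) renaming ([] to []ᵛ; replicate to replicateᵛ)
open import Data.Fin using (fromℕ)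

-- Polynomials in ℚ[x]: coefficient lists, ascending powers (index i = coeff of x^i).
Poly : Set
Poly = List ℚ

infixl 6 _+ₚ_
_+ₚ_ : Poly → Poly → Poly
[]      +ₚ q       = q
(a ∷ p) +ₚ []      = a ∷ p
(a ∷ p) +ₚ (b ∷ q) = (a + b) ∷ (p +ₚ q)

scale : ℚ → Poly → Poly
scale c []      = []
scale c (a ∷ p) = (c * a) ∷ scale c p

infixl 7 _*ₚ_
_*ₚ_ : Poly → Poly → Poly
[]      *ₚ q = []
(a ∷ p) *ₚ q = scale a q +ₚ (0ℚ ∷ (p *ₚ q))

oneₚ : Poly
oneₚ = [ 1ℚ ]

_^ₚ_ : Poly → ℕ → Poly
p ^ₚ zero  = oneₚ
p ^ₚ suc n = p *ₚ (p ^ₚ n)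

monomial : ℕ → Poly
monomial k = replicate k 0ℚ ++ [ 1ℚ ]

-- Residues modulo x^N + x - 1 (N = suc k): polynomials of degree ≤ N-1,
-- as coefficient vectors of length N (index i = coeff of x^i).
-- Multiplication of a residue by x: the resulting x^N term c·x^N is
-- replaced by c·(1 - x).
subHead : ∀ {m} → Vec ℚ m → ℚ → Vec ℚ m
subHead []ᵛ      c = []ᵛ
subHead (a ∷ as) c = (a - c) ∷ as

mulX : ∀ {k} → Vec ℚ (suc k) → Vec ℚ (suc k)
mulX v = last v ∷ subHead (init v) (last v)

addHead : ∀ {k} → ℚ → Vec ℚ (suc k) → Vec ℚ (suc k)
addHead a (b ∷ bs) = (a + b) ∷ bs

-- Remainder of a polynomial upon division by x^(suc k) + x - 1,
-- computed by Horner's scheme: rem (a + x·p) = a + x·rem p (reduced).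
remainder : ∀ k → Poly → Vec ℚ (suc k)
remainder k []      = replicateᵛ (suc k) 0ℚ
remainder k (a ∷ p) = addHead a (mulX (remainder k p))

-- κ N n = coefficient of x^(N-1) in the remainder of (x^(N-1) + 1)^n
-- upon division by x^N + x - 1.  (Only meaningful for N ≥ 1; N = 0 is a dummy case.)
κ : ℕ → ℕ → ℚ
κ zero    n = 0ℚ
κ (suc k) n = lookup (remainder k ((monomial k +ₚ oneₚ) ^ₚ n)) (fromℕ k)

-- Write K = N - 1 and X for multiplication by x on residues. Since (x^K + 1)·r = r + X^K r, it
-- suffices to know X^K on the residues
--   σ c = 1 + x^(c+1) + ⋯ + x^K          (0 ≤ c ≤ K; σ K = 1).
-- For c < K, x·σ c = x + x^(c+2) + ⋯ + x^K + (1 - x) = σ (c + 1), so X^(K-c) (σ c) = σ K = 1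
-- and hence X^K (σ c) = x^c. Consequently the residue of (x^K + 1)^n is σ (K - n) for n ≤ K,
-- because σ (c + 1) + x^(c+1) = σ c, and its coefficient of x^K is 1 exactly when K - n < K.
module Submission where

open import Defs
open import Data.Bool using (Bool; true; false)
open import Data.Fin using (Fin; toℕ; fromℕ)
import Data.Fin as Fin
open import Data.Fin.Properties using (toℕ-fromℕ)
open import Data.List using ([]; _∷_)
open import Data.Nat using (ℕ; zero; suc; _≤_; _<_; _∸_; z≤n; s≤s; s≤s⁻¹; _<ᵇ_; _≡ᵇ_)
import Data.Nat as Nat
open import Data.Nat.Properties
  using (≤-refl; ≤-reflexive; <⇒≤; ≤-trans; m≤m+n; +-comm; +-suc; +-identityʳ; m∸n+n≡m; ∸-monoʳ-<)
open import Data.Product using (_×_; _,_)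
open import Data.Rational using (ℚ; 0ℚ; 1ℚ; _+_; _-_; _*_)
import Data.Rational.Properties as ℚ
open import Data.Rational.Solver using (module +-*-Solver)
open import Data.Vec using (Vec; _∷_; last; init; lookup; zipWith; map)
  renaming ([] to []ᵛ; replicate to replicateᵛ)
open import Data.Vec.Properties
  using (zipWith-identityˡ; zipWith-identityʳ; map-cong; map-id; map-const; map-replicate)
open import Function using (_∘_)
open import Relation.Binary.PropositionalEquality
  using (_≡_; refl; sym; trans; cong; cong₂; module ≡-Reasoning)

open +-*-Solver using (solve; _:+_; _:-_; _:*_; _:=_)

private
  variable
    A B C : Set
    n : ℕ

last-zipWith : ∀ (f : A → B → C) (u : Vec A (suc n)) w → last (zipWith f u w) ≡ f (last u) (last w)
last-zipWith {n = zero}  f (x ∷ []ᵛ) (y ∷ []ᵛ) = refl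
last-zipWith {n = suc n} f (x ∷ u)   (y ∷ w)   = last-zipWith f u w

init-zipWith : ∀ (f : A → B → C) (u : Vec A (suc n)) w → init (zipWith f u w) ≡ zipWith f (init u) (init w)
init-zipWith {n = zero}  f (x ∷ []ᵛ) (y ∷ []ᵛ) = refl
init-zipWith {n = suc n} f (x ∷ u)   (y ∷ w)   = cong (f x y ∷_) (init-zipWith f u w)

last-map : ∀ (f : A → B) (u : Vec A (suc n)) → last (map f u) ≡ f (last u)
last-map {n = zero}  f (x ∷ []ᵛ) = refl
last-map {n = suc n} f (x ∷ u)   = last-map f u

init-map : ∀ (f : A → B) (u : Vec A (suc n)) → init (map f u) ≡ map f (init u)
init-map {n = zero}  f (x ∷ []ᵛ) = refl
init-map {n = suc n} f (x ∷ u)   = cong (f x ∷_) (init-map f u)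

last-replicate : ∀ (x : A) → last (replicateᵛ (suc n) x) ≡ x
last-replicate {n = zero}  x = refl
last-replicate {n = suc n} x = last-replicate {n = n} x

init-replicate : ∀ (x : A) → init (replicateᵛ (suc n) x) ≡ replicateᵛ n x
init-replicate {n = zero}  x = refl
init-replicate {n = suc n} x = cong (x ∷_) (init-replicate x)

infixl 6 _⊕_
infixr 7 _⊙_

_⊕_ : Vec ℚ n → Vec ℚ n → Vec ℚ n
_⊕_ = zipWith _+_

_⊙_ : ℚ → Vec ℚ n → Vec ℚ n
c ⊙ w = map (c *_) w

0ᵥ : Vec ℚ n
0ᵥ = replicateᵛ _ 0ℚ

⊕-identityˡ : (w : Vec ℚ n) → 0ᵥ ⊕ w ≡ w
⊕-identityˡ = zipWith-identityˡ ℚ.+-identityˡ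

⊕-identityʳ : (w : Vec ℚ n) → w ⊕ 0ᵥ ≡ w
⊕-identityʳ = zipWith-identityʳ ℚ.+-identityʳ

⊙-identityˡ : (w : Vec ℚ n) → 1ℚ ⊙ w ≡ w
⊙-identityˡ w = trans (map-cong ℚ.*-identityˡ w) (map-id w)

⊙-zeroˡ : (w : Vec ℚ n) → 0ℚ ⊙ w ≡ 0ᵥ
⊙-zeroˡ w = trans (map-cong ℚ.*-zeroˡ w) (map-const w 0ℚ)

⊙-zeroʳ : ∀ c → c ⊙ 0ᵥ {n} ≡ 0ᵥ
⊙-zeroʳ {n} c = trans (map-replicate (c *_) 0ℚ n) (cong (replicateᵛ n) (ℚ.*-zeroʳ c))

subHead-⊕ : (u w : Vec ℚ n) → ∀ a b → subHead (u ⊕ w) (a + b) ≡ subHead u a ⊕ subHead w b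
subHead-⊕ []ᵛ      []ᵛ      a b = refl
subHead-⊕ (x ∷ u) (y ∷ w) a b = cong (_∷ u ⊕ w) (interchange x y a b)
  where
  interchange : ∀ x y a b → (x + y) - (a + b) ≡ (x - a) + (y - b)
  interchange = solve 4 (λ x y a b → (x :+ y) :- (a :+ b) := (x :- a) :+ (y :- b)) refl

subHead-⊙ : ∀ c (u : Vec ℚ n) a → subHead (c ⊙ u) (c * a) ≡ c ⊙ subHead u a
subHead-⊙ c []ᵛ     a = refl
subHead-⊙ c (x ∷ u) a = cong (_∷ c ⊙ u) (distrib c x a)
  where
  distrib : ∀ c x a → c * x - c * a ≡ c * (x - a)
  distrib = solve 3 (λ c x a → c :* x :- c :* a := c :* (x :- a)) refl

subHead-0ᵥ : subHead (0ᵥ {n}) 0ℚ ≡ 0ᵥ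
subHead-0ᵥ {zero}  = refl
subHead-0ᵥ {suc n} = cong (_∷ 0ᵥ) (ℚ.+-inverseʳ 0ℚ)

addHead-⊕ : ∀ a b (u w : Vec ℚ (suc n)) → addHead (a + b) (u ⊕ w) ≡ addHead a u ⊕ addHead b w
addHead-⊕ a b (x ∷ u) (y ∷ w) = cong (_∷ u ⊕ w) (interchange a b x y)
  where
  interchange : ∀ a b x y → (a + b) + (x + y) ≡ (a + x) + (b + y)
  interchange = solve 4 (λ a b x y → (a :+ b) :+ (x :+ y) := (a :+ x) :+ (b :+ y)) refl

addHead-⊙ : ∀ c a (u : Vec ℚ (suc n)) → addHead (c * a) (c ⊙ u) ≡ c ⊙ addHead a u
addHead-⊙ c a (x ∷ u) = cong (_∷ c ⊙ u) (sym (ℚ.*-distribˡ-+ c a x))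

addHead-0ℚ : (u : Vec ℚ (suc n)) → addHead 0ℚ u ≡ u
addHead-0ℚ (x ∷ u) = cong (_∷ u) (ℚ.+-identityˡ x)

mulX-≡ : ∀ {v : Vec ℚ (suc n)} {a u} → last v ≡ a → init v ≡ u → mulX v ≡ a ∷ subHead u a
mulX-≡ refl refl = refl

mulX-⊕ : (u w : Vec ℚ (suc n)) → mulX (u ⊕ w) ≡ mulX u ⊕ mulX w
mulX-⊕ u w = trans (mulX-≡ (last-zipWith _+_ u w) (init-zipWith _+_ u w))
                   (cong (last u + last w ∷_) (subHead-⊕ (init u) (init w) (last u) (last w)))

mulX-⊙ : ∀ c (u : Vec ℚ (suc n)) → mulX (c ⊙ u) ≡ c ⊙ mulX u
mulX-⊙ c u = trans (mulX-≡ (last-map (c *_) u) (init-map (c *_) u))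
                   (cong (c * last u ∷_) (subHead-⊙ c (init u) (last u)))

mulX-0ᵥ : mulX (0ᵥ {suc n}) ≡ 0ᵥ
mulX-0ᵥ {n} = trans (mulX-≡ (last-replicate {n = n} 0ℚ) (init-replicate 0ℚ)) (cong (0ℚ ∷_) subHead-0ᵥ)

remainder-+ₚ : ∀ k p q → remainder k (p +ₚ q) ≡ remainder k p ⊕ remainder k q
remainder-+ₚ k []      q       = sym (⊕-identityˡ (remainder k q))
remainder-+ₚ k (a ∷ p) []      = sym (⊕-identityʳ (remainder k (a ∷ p)))
remainder-+ₚ k (a ∷ p) (b ∷ q) = begin
  addHead (a + b) (mulX (remainder k (p +ₚ q)))
    ≡⟨ cong (addHead (a + b) ∘ mulX) (remainder-+ₚ k p q) ⟩
  addHead (a + b) (mulX (remainder k p ⊕ remainder k q))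
    ≡⟨ cong (addHead (a + b)) (mulX-⊕ (remainder k p) (remainder k q)) ⟩
  addHead (a + b) (mulX (remainder k p) ⊕ mulX (remainder k q))
    ≡⟨ addHead-⊕ a b _ _ ⟩
  remainder k (a ∷ p) ⊕ remainder k (b ∷ q) ∎
  where open ≡-Reasoning

remainder-scale : ∀ k c p → remainder k (scale c p) ≡ c ⊙ remainder k p
remainder-scale k c []      = sym (⊙-zeroʳ c)
remainder-scale k c (a ∷ p) = begin
  addHead (c * a) (mulX (remainder k (scale c p)))
    ≡⟨ cong (addHead (c * a) ∘ mulX) (remainder-scale k c p) ⟩
  addHead (c * a) (mulX (c ⊙ remainder k p))
    ≡⟨ cong (addHead (c * a)) (mulX-⊙ c (remainder k p)) ⟩
  addHead (c * a) (c ⊙ mulX (remainder k p))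
    ≡⟨ addHead-⊙ c a _ ⟩
  c ⊙ remainder k (a ∷ p) ∎
  where open ≡-Reasoning

remainder-oneₚ : ∀ k → remainder k oneₚ ≡ 1ℚ ∷ 0ᵥ
remainder-oneₚ k = trans (cong (addHead 1ℚ) mulX-0ᵥ) (cong (_∷ 0ᵥ) (ℚ.+-identityʳ 1ℚ))

-- A polynomial p acts on residues as p(X), X = mulX, evaluated by Horner's rule.
act : Poly → Vec ℚ (suc n) → Vec ℚ (suc n)
act []      w = 0ᵥ
act (a ∷ p) w = a ⊙ w ⊕ mulX (act p w)

remainder-*ₚ : ∀ k p q → remainder k (p *ₚ q) ≡ act p (remainder k q)
remainder-*ₚ k []      q = refl
remainder-*ₚ k (a ∷ p) q = begin
  remainder k (scale a q +ₚ (0ℚ ∷ p *ₚ q))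
    ≡⟨ remainder-+ₚ k (scale a q) (0ℚ ∷ p *ₚ q) ⟩
  remainder k (scale a q) ⊕ addHead 0ℚ (mulX (remainder k (p *ₚ q)))
    ≡⟨ cong₂ _⊕_ (remainder-scale k a q) (addHead-0ℚ _) ⟩
  a ⊙ remainder k q ⊕ mulX (remainder k (p *ₚ q))
    ≡⟨ cong (λ r → a ⊙ remainder k q ⊕ mulX r) (remainder-*ₚ k p q) ⟩
  act (a ∷ p) (remainder k q) ∎
  where open ≡-Reasoning

mulXⁿ : ℕ → Vec ℚ (suc n) → Vec ℚ (suc n)
mulXⁿ zero    w = w
mulXⁿ (suc j) w = mulX (mulXⁿ j w)

mulXⁿ-+ : ∀ i j (w : Vec ℚ (suc n)) → mulXⁿ (i Nat.+ j) w ≡ mulXⁿ i (mulXⁿ j w)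
mulXⁿ-+ zero    j w = refl
mulXⁿ-+ (suc i) j w = cong mulX (mulXⁿ-+ i j w)

+ₚ-identityʳ : ∀ p → p +ₚ [] ≡ p
+ₚ-identityʳ []      = refl
+ₚ-identityʳ (a ∷ p) = refl

act-monomial : ∀ j (w : Vec ℚ (suc n)) → act (monomial j) w ≡ mulXⁿ j w
act-monomial zero    w = trans (cong₂ _⊕_ (⊙-identityˡ w) mulX-0ᵥ) (⊕-identityʳ w)
act-monomial (suc j) w = trans (cong₂ _⊕_ (⊙-zeroˡ w) (cong mulX (act-monomial j w))) (⊕-identityˡ _)

act-binomial : ∀ j (w : Vec ℚ (suc n)) → act (monomial (suc j) +ₚ oneₚ) w ≡ w ⊕ mulXⁿ (suc j) w
act-binomial j w = begin
  (0ℚ + 1ℚ) ⊙ w ⊕ mulX (act (monomial j +ₚ []) w)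
    ≡⟨ cong₂ (λ a p → a ⊙ w ⊕ mulX (act p w)) (ℚ.+-identityˡ 1ℚ) (+ₚ-identityʳ (monomial j)) ⟩
  1ℚ ⊙ w ⊕ mulX (act (monomial j) w)
    ≡⟨ cong₂ _⊕_ (⊙-identityˡ w) (cong mulX (act-monomial j w)) ⟩
  w ⊕ mulXⁿ (suc j) w ∎
  where open ≡-Reasoning

coeffVec : (n : ℕ) → (ℕ → A) → Vec A n
coeffVec zero    f = []ᵛ
coeffVec (suc n) f = f 0 ∷ coeffVec n (f ∘ suc)

lookup-coeffVec : ∀ (f : ℕ → A) (i : Fin n) → lookup (coeffVec n f) i ≡ f (toℕ i)
lookup-coeffVec f Fin.zero    = refl
lookup-coeffVec f (Fin.suc i) = lookup-coeffVec (f ∘ suc) i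

last-coeffVec : ∀ n (f : ℕ → A) → last (coeffVec (suc n) f) ≡ f n
last-coeffVec zero    f = refl
last-coeffVec (suc n) f = last-coeffVec n (f ∘ suc)

init-coeffVec : ∀ n (f : ℕ → A) → init (coeffVec (suc n) f) ≡ coeffVec n f
init-coeffVec zero    f = refl
init-coeffVec (suc n) f = cong (f 0 ∷_) (init-coeffVec n (f ∘ suc))

coeffVec-cong : ∀ n {f g : ℕ → A} → (∀ t → t < n → f t ≡ g t) → coeffVec n f ≡ coeffVec n g
coeffVec-cong zero    eq = refl
coeffVec-cong (suc n) eq = cong₂ _∷_ (eq 0 (s≤s z≤n)) (coeffVec-cong n (λ t t<n → eq (suc t) (s≤s t<n)))

coeffVec-const : ∀ n (a : A) → coeffVec n (λ _ → a) ≡ replicateᵛ n a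
coeffVec-const zero    a = refl
coeffVec-const (suc n) a = cong (a ∷_) (coeffVec-const n a)

coeffVec-zipWith : ∀ n (h : A → B → C) f g →
                   zipWith h (coeffVec n f) (coeffVec n g) ≡ coeffVec n (λ t → h (f t) (g t))
coeffVec-zipWith zero    h f g = refl
coeffVec-zipWith (suc n) h f g = cong (h (f 0) (g 0) ∷_) (coeffVec-zipWith n h (f ∘ suc) (g ∘ suc))

-- The coefficients of x·f modulo x^(K+1) + x - 1, for K ≥ 1.
mulXCoeffs : ℕ → (ℕ → ℚ) → ℕ → ℚ
mulXCoeffs K f zero          = f K
mulXCoeffs K f (suc zero)    = f 0 - f K
mulXCoeffs K f (suc (suc t)) = f (suc t)

mulX-coeffVec : ∀ k f → mulX (coeffVec (suc (suc k)) f) ≡ coeffVec (suc (suc k)) (mulXCoeffs (suc k) f)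
mulX-coeffVec k f = mulX-≡ {v = coeffVec (suc (suc k)) f} (last-coeffVec (suc k) f) (init-coeffVec (suc k) f)

𝟙 : Bool → ℚ
𝟙 true  = 1ℚ
𝟙 false = 0ℚ

𝟙-<ᵇ : ∀ {m n} → m < n → 𝟙 (m <ᵇ n) ≡ 1ℚ
𝟙-<ᵇ {zero}  (s≤s _)   = refl
𝟙-<ᵇ {suc m} (s≤s m<n) = 𝟙-<ᵇ m<n

𝟙-≮ᵇ : ∀ {m n} → n ≤ m → 𝟙 (m <ᵇ n) ≡ 0ℚ
𝟙-≮ᵇ z≤n       = refl
𝟙-≮ᵇ (s≤s n≤m) = 𝟙-≮ᵇ n≤m

𝟙-≢ᵇ : ∀ {m n} → m < n → 𝟙 (n ≡ᵇ m) ≡ 0ℚ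
𝟙-≢ᵇ {zero}  (s≤s _)   = refl
𝟙-≢ᵇ {suc m} (s≤s m<n) = 𝟙-≢ᵇ m<n

𝟙-<ᵇ-suc : ∀ m n → 𝟙 (m <ᵇ n) + 𝟙 (n ≡ᵇ m) ≡ 𝟙 (m <ᵇ suc n)
𝟙-<ᵇ-suc zero    zero    = ℚ.+-identityˡ 1ℚ
𝟙-<ᵇ-suc zero    (suc n) = ℚ.+-identityʳ 1ℚ
𝟙-<ᵇ-suc (suc m) zero    = ℚ.+-identityʳ 0ℚ
𝟙-<ᵇ-suc (suc m) (suc n) = 𝟙-<ᵇ-suc m n

unit : ℕ → ℕ → ℚ
unit j t = 𝟙 (t ≡ᵇ j)

-- σ c t is the coefficient of x^t in 1 + x^(c+1) + x^(c+2) + ⋯ .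
σ : ℕ → ℕ → ℚ
σ c zero    = 1ℚ
σ c (suc t) = 𝟙 (c <ᵇ suc t)

mulXCoeffs-unit : ∀ {K j} → j < K → ∀ t → mulXCoeffs K (unit j) t ≡ unit (suc j) t
mulXCoeffs-unit         j<K zero          = 𝟙-≢ᵇ j<K
-- x - 0ℚ reduces to x + 0ℚ.
mulXCoeffs-unit {j = j} j<K (suc zero)    = trans (cong (unit j 0 -_) (𝟙-≢ᵇ j<K)) (ℚ.+-identityʳ (unit j 0))
mulXCoeffs-unit         j<K (suc (suc t)) = refl

mulXCoeffs-σ : ∀ {K c} → c < K → ∀ t → mulXCoeffs K (σ c) t ≡ σ (suc c) t
mulXCoeffs-σ {K = suc K} c<K zero          = 𝟙-<ᵇ c<K
mulXCoeffs-σ {K = suc K} c<K (suc zero)    = trans (cong (1ℚ -_) (𝟙-<ᵇ c<K)) (ℚ.+-inverseʳ 1ℚ)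
mulXCoeffs-σ             c<K (suc (suc t)) = refl

σ-unit : ∀ c t → σ (suc c) t + unit (suc c) t ≡ σ c t
σ-unit c zero    = ℚ.+-identityʳ 1ℚ
σ-unit c (suc t) = 𝟙-<ᵇ-suc c t

σ-top : ∀ {K t} → t ≤ K → σ K t ≡ unit 0 t
σ-top {t = zero}  _        = refl
σ-top {t = suc t} suc-t≤K = 𝟙-≮ᵇ suc-t≤K

module _ (k : ℕ) where
  private
    K : ℕ
    K = suc k

    ⟦_⟧ : (ℕ → ℚ) → Vec ℚ (suc K)
    ⟦_⟧ = coeffVec (suc K)

  mulX-unit : ∀ {j} → j < K → mulX ⟦ unit j ⟧ ≡ ⟦ unit (suc j) ⟧
  mulX-unit {j} j<K = trans (mulX-coeffVec k (unit j)) (coeffVec-cong (suc K) (λ t _ → mulXCoeffs-unit j<K t))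

  mulX-σ : ∀ {c} → c < K → mulX ⟦ σ c ⟧ ≡ ⟦ σ (suc c) ⟧
  mulX-σ {c} c<K = trans (mulX-coeffVec k (σ c)) (coeffVec-cong (suc K) (λ t _ → mulXCoeffs-σ c<K t))

  mulXⁿ-unit : ∀ j → j ≤ K → mulXⁿ j ⟦ unit 0 ⟧ ≡ ⟦ unit j ⟧
  mulXⁿ-unit zero    _   = refl
  mulXⁿ-unit (suc j) j<K = trans (cong mulX (mulXⁿ-unit j (<⇒≤ j<K))) (mulX-unit j<K)

  mulXⁿ-σ : ∀ j c → j Nat.+ c ≤ K → mulXⁿ j ⟦ σ c ⟧ ≡ ⟦ σ (j Nat.+ c) ⟧
  mulXⁿ-σ zero    c _     = refl
  mulXⁿ-σ (suc j) c j+c<K = trans (cong mulX (mulXⁿ-σ j c (<⇒≤ j+c<K))) (mulX-σ j+c<K)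

  σ-top-coeffVec : ⟦ σ K ⟧ ≡ ⟦ unit 0 ⟧
  σ-top-coeffVec = coeffVec-cong (suc K) (λ t t<suc-K → σ-top (s≤s⁻¹ t<suc-K))

  mulXᴷ-σ : ∀ c n → c Nat.+ n ≡ K → mulXⁿ K ⟦ σ c ⟧ ≡ ⟦ unit c ⟧
  mulXᴷ-σ c n c+n≡K = begin
    mulXⁿ K ⟦ σ c ⟧                  ≡⟨ cong (λ m → mulXⁿ m ⟦ σ c ⟧) (sym c+n≡K) ⟩
    mulXⁿ (c Nat.+ n) ⟦ σ c ⟧        ≡⟨ mulXⁿ-+ c n ⟦ σ c ⟧ ⟩
    mulXⁿ c (mulXⁿ n ⟦ σ c ⟧)        ≡⟨ cong (mulXⁿ c) (mulXⁿ-σ n c (≤-reflexive n+c≡K)) ⟩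
    mulXⁿ c ⟦ σ (n Nat.+ c) ⟧        ≡⟨ cong (λ m → mulXⁿ c ⟦ σ m ⟧) n+c≡K ⟩
    mulXⁿ c ⟦ σ K ⟧                  ≡⟨ cong (mulXⁿ c) σ-top-coeffVec ⟩
    mulXⁿ c ⟦ unit 0 ⟧               ≡⟨ mulXⁿ-unit c (≤-trans (m≤m+n c n) (≤-reflexive c+n≡K)) ⟩
    ⟦ unit c ⟧                       ∎
    where
    open ≡-Reasoning
    n+c≡K : n Nat.+ c ≡ K
    n+c≡K = trans (+-comm n c) c+n≡K

  σ-unit-coeffVec : ∀ c → ⟦ σ (suc c) ⟧ ⊕ ⟦ unit (suc c) ⟧ ≡ ⟦ σ c ⟧
  σ-unit-coeffVec c = trans (coeffVec-zipWith (suc K) _+_ (σ (suc c)) (unit (suc c)))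
                            (coeffVec-cong (suc K) (λ t _ → σ-unit c t))

  remainder-oneₚ-σ : remainder K oneₚ ≡ ⟦ σ K ⟧
  remainder-oneₚ-σ = begin
    remainder K oneₚ           ≡⟨ remainder-oneₚ K ⟩
    1ℚ ∷ replicateᵛ K 0ℚ       ≡⟨ cong (1ℚ ∷_) (sym (coeffVec-const K 0ℚ)) ⟩
    ⟦ unit 0 ⟧                 ≡⟨ sym σ-top-coeffVec ⟩
    ⟦ σ K ⟧                    ∎
    where open ≡-Reasoning

  remainder-binomial-^ₚ : ∀ c n → c Nat.+ n ≡ K → remainder K ((monomial K +ₚ oneₚ) ^ₚ n) ≡ ⟦ σ c ⟧
  remainder-binomial-^ₚ c zero c+0≡K =
    trans remainder-oneₚ-σ (cong (λ m → ⟦ σ m ⟧) (sym (trans (sym (+-identityʳ c)) c+0≡K)))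
  remainder-binomial-^ₚ c (suc n) c+1+n≡K = begin
    remainder K (P *ₚ P ^ₚ n)                 ≡⟨ remainder-*ₚ K P (P ^ₚ n) ⟩
    act P (remainder K (P ^ₚ n))              ≡⟨ cong (act P) (remainder-binomial-^ₚ (suc c) n 1+c+n≡K) ⟩
    act P ⟦ σ (suc c) ⟧                       ≡⟨ act-binomial k ⟦ σ (suc c) ⟧ ⟩
    ⟦ σ (suc c) ⟧ ⊕ mulXⁿ K ⟦ σ (suc c) ⟧     ≡⟨ cong (⟦ σ (suc c) ⟧ ⊕_) (mulXᴷ-σ (suc c) n 1+c+n≡K) ⟩
    ⟦ σ (suc c) ⟧ ⊕ ⟦ unit (suc c) ⟧          ≡⟨ σ-unit-coeffVec c ⟩
    ⟦ σ c ⟧                                   ∎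
    where
    open ≡-Reasoning
    P : Poly
    P = monomial K +ₚ oneₚ
    1+c+n≡K : suc c Nat.+ n ≡ K
    1+c+n≡K = trans (sym (+-suc c n)) c+1+n≡K

  κ-σ : ∀ c n → c Nat.+ n ≡ K → κ (suc K) n ≡ σ c K
  κ-σ c n c+n≡K = begin
    lookup (remainder K ((monomial K +ₚ oneₚ) ^ₚ n)) (fromℕ K)
      ≡⟨ cong (λ v → lookup v (fromℕ K)) (remainder-binomial-^ₚ c n c+n≡K) ⟩
    lookup ⟦ σ c ⟧ (fromℕ K)
      ≡⟨ lookup-coeffVec (σ c) (fromℕ K) ⟩
    σ c (toℕ (fromℕ K))
      ≡⟨ cong (σ c) (toℕ-fromℕ K) ⟩
    σ c K ∎
    where open ≡-Reasoning

mainTheorem3 : (N : ℕ) → 2 ≤ N →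
    (κ N 0 ≡ 0ℚ) × ((n : ℕ) → 0 < n → n ≤ N ∸ 1 → κ N n ≡ 1ℚ)
mainTheorem3 (suc (suc k)) (s≤s (s≤s z≤n)) = κ-zero , κ-positive
  where
  κ-zero : κ (suc (suc k)) 0 ≡ 0ℚ
  κ-zero = trans (κ-σ k (suc k) 0 (+-identityʳ (suc k))) (𝟙-≮ᵇ (≤-refl {suc k}))

  κ-positive : ∀ n → 0 < n → n ≤ suc k → κ (suc (suc k)) n ≡ 1ℚ
  κ-positive n 0<n n≤K = trans (κ-σ k (suc k ∸ n) n (m∸n+n≡m n≤K)) (𝟙-<ᵇ (∸-monoʳ-< 0<n n≤K))
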